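{- Let $S$ be a string of length $n$ ending with the unique end symbol $\$$, and let $\zeta$ be a node of the rotation-trie $\mathcal{T}(S)$ at level $k<n$ that has exactly one child $\phi$. (1) If $\zeta$ has a unique Weiner link, then $w_{k+1}(\phi)=1$. (2) If $\zeta$ has multiple Weiner links, then $w_{k+1}(\phi)=w_k(\zeta)$.
   Context: $\Sigma$ is a finite totally ordered alphabet containing a symbol $\$$ smaller than all other symbols; $S$ is a string of length $n$ over $\Sigma$ whose last character is $\$$ and in which $\$$ occurs nowhere else. The rotation-trie $\mathcal{T}(S)$ is the trie of the $n$ (distinct) rotations $S[i..n]S[1..i-1]$ of $S$, children ordered by lexicographic order of labels; $l(\phi)$ is the root-to-$\phi$ label, the level of $\phi$ is $|l(\phi)|$, $\mathcal{T}_k(S)$ is the set of level-$k$ nodes, and $|\phi|$ is the number of leaves in the subtree rooted at $\phi$. For nodes $\phi,\varphi$ and $c\in\Sigma$, $(\phi,\varphi,c)$ is a Weiner link of $\phi$ if $l(\varphi)=c\,l(\phi)$, or $|l(\phi)|=n$ and $l(\varphi)=c\,l(\phi)[1..n-1]$. A Weiner link $(\phi,\varphi,c)$ is unique if $\phi$ has no other Weiner link $(\phi,\psi,d)$ with $\psi\neq\varphi$; a node has multiple Weiner links if it has Weiner links to at least two distinct nodes. Weights: for $\phi\in\mathcal{T}_k(S)$, $w_k(\phi)=1$ if $\phi$ has a unique Weiner link $(\phi,\varphi,c)$ and $\varphi$ has no siblings, and $w_k(\phi)=|\phi|$ otherwise. -}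

module Defs where

open import Data.Nat using (ℕ; zero; suc; pred; _<_)
open import Data.Fin as Fin using (Fin)
open import Data.Fin.Properties using (_≟_)
open import Data.List using (List; []; _∷_; _++_; _∷ʳ_; length; drop; take; filter; upTo)
open import Data.List.Relation.Unary.All using (All)
open import Data.List.Relation.Binary.Prefix.Heterogeneous using (Prefix)
open import Data.List.Relation.Binary.Prefix.Heterogeneous.Properties using (prefix?)
open import Data.Product using (Σ; ∃; ∃-syntax; _×_)
open import Data.Sum using (_⊎_)
open import Relation.Binary.PropositionalEquality using (_≡_; _≢_)
open import Relation.Nullary using (¬_)

-- Alphabet: a finite totally ordered alphabet, represented (up to order
-- isomorphism) as Fin (suc σ); the end symbol $ is the least element zero.
Alph : ℕ → Set
Alph σ = Fin (suc σ)

$ : ∀ {σ} → Alph σ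
$ = Fin.zero

Word : ℕ → Set
Word σ = List (Alph σ)

EndMarked : ∀ {σ} → Word σ → Set
EndMarked {σ} S = Σ (Word σ) λ T → (S ≡ T ∷ʳ $) × All (λ a → a ≢ $) T

-- Rotation number i (0-based): S[i+1..n] S[1..i].
rot : ∀ {σ} → Word σ → ℕ → Word σ
rot S i = drop i S ++ take i S

_≼_ : ∀ {σ} → Word σ → Word σ → Set
u ≼ v = Prefix _≡_ u v

-- Nodes of the rotation trie T(S) are identified with their labels:
-- the prefixes of the rotations of S.
IsNode : ∀ {σ} → Word σ → Word σ → Set
IsNode S w = ∃[ i ] (i < length S × w ≼ rot S i)

AtLevel : ∀ {σ} → Word σ → ℕ → Word σ → Set
AtLevel S k w = IsNode S w × length w ≡ k

-- |φ| : number of leaves below φ = number of rotations having l(φ) as prefix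
-- (rotations are pairwise distinct, so each leaf corresponds to one index).
size : ∀ {σ} → Word σ → Word σ → ℕ
size S w = length (filter (λ i → prefix? _≟_ w (rot S i)) (upTo (length S)))

Child : ∀ {σ} → Word σ → Word σ → Word σ → Set
Child S ζ ψ = IsNode S ψ × ∃[ d ] (ψ ≡ ζ ∷ʳ d)

WeinerLink : ∀ {σ} → Word σ → Word σ → Word σ → Alph σ → Set
WeinerLink S φ ψ c =
  IsNode S φ × IsNode S ψ ×
  ((ψ ≡ c ∷ φ) ⊎ (length φ ≡ length S × ψ ≡ c ∷ take (pred (length S)) φ))

UniqueWeinerLinkTo : ∀ {σ} → Word σ → Word σ → Word σ → Alph σ → Set
UniqueWeinerLinkTo S φ ψ c =
  WeinerLink S φ ψ c × (∀ ψ′ d → WeinerLink S φ ψ′ d → ψ′ ≡ ψ)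

HasUniqueWeinerLink : ∀ {σ} → Word σ → Word σ → Set
HasUniqueWeinerLink S φ = ∃[ ψ ] ∃[ c ] UniqueWeinerLinkTo S φ ψ c

HasMultipleWeinerLinks : ∀ {σ} → Word σ → Word σ → Set
HasMultipleWeinerLinks S φ =
  ∃[ ψ₁ ] ∃[ c₁ ] ∃[ ψ₂ ] ∃[ c₂ ]
    (WeinerLink S φ ψ₁ c₁ × WeinerLink S φ ψ₂ c₂ × ψ₁ ≢ ψ₂)

Sibling : ∀ {σ} → Word σ → Word σ → Word σ → Set
Sibling S ψ ψ′ =
  IsNode S ψ′ × ψ′ ≢ ψ × ∃[ p ] ∃[ d ] ∃[ e ] (ψ ≡ p ∷ʳ d × ψ′ ≡ p ∷ʳ e)

NoSiblings : ∀ {σ} → Word σ → Word σ → Set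
NoSiblings S ψ = ∀ ψ′ → ¬ Sibling S ψ ψ′

WeightOneCond : ∀ {σ} → Word σ → Word σ → Set
WeightOneCond S φ = ∃[ ψ ] ∃[ c ] (UniqueWeinerLinkTo S φ ψ c × NoSiblings S ψ)

-- Weight k S φ m  :⇔  φ ∈ T_k(S) and w_k(φ) = m.
Weight : ∀ {σ} → Word σ → ℕ → Word σ → ℕ → Set
Weight S k φ m =
  AtLevel S k φ ×
  ((WeightOneCond S φ × m ≡ 1) ⊎ (¬ WeightOneCond S φ × m ≡ size S φ))

module Submission where

-- The rotations
-- are closed under moving the first letter to the end, and each of them is a
-- permutation of S; the latter shows that a rotation is determined by all of
-- its letters but the last, so a full-length node has no siblings.
--
-- The single-child hypothesis says that ζ is always followed by the letter d
-- with φ = ζ d: every rotation beginning with ζ continues with d.  This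
-- property survives prepending a letter c (as long as c ζ d still fits into a
-- rotation), so c ζ is a node iff c φ is, and c φ has no sibling.  Hence the
-- Weiner links of ζ and of φ are both indexed by the same set of letters
-- {c | c ζ is a node}, with targets c ζ and c τ, where τ = φ, or τ = ζ when φ
-- has full length n.  Unique and multiple Weiner links therefore transfer
-- from ζ to φ, the targets of φ have no siblings, and ζ and φ have the same
-- leaves.  Part (1) follows: φ satisfies the weight-one condition.  Part (2):
-- neither ζ nor φ satisfies it, so both weights are the (equal) sizes.

open import Defs
open import Function using (_∘_)
open import Data.Nat using (ℕ; zero; suc; pred; _<_; _≤_; z≤n; s≤s)
open import Data.Nat.Properties
  using (<-irrefl; ≤-<-trans; ≮⇒≥; m≤n⇒m<n∨m≡n; m+1+n≢m; +-comm; _<?_)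
open import Data.Fin.Properties using (_≟_)
open import Data.List using (List; []; _∷_; _++_; _∷ʳ_; length; drop; take; upTo; [_])
open import Data.List.Properties
  using (++-assoc; ++-identityʳ; length-++; take++drop≡id; drop-all; take-all;
         ∷-injective; ∷-injectiveˡ; ∷ʳ-injective; ∷ʳ-injectiveʳ; filter-≐)
open import Data.List.Relation.Binary.Prefix.Heterogeneous using (Prefix; []; _∷_)
open import Data.List.Relation.Binary.Prefix.Heterogeneous.Properties
  using (prefix?; length-mono)
open import Data.List.Relation.Binary.Permutation.Propositional
  using (_↭_; ↭-trans; ↭-sym; ↭-reflexive)
open import Data.List.Relation.Binary.Permutation.Propositional.Properties
  using (drop-∷; ↭-singleton-inv; ↭-length) renaming (++-comm to ↭-++-comm)
open import Data.Product using (∃-syntax; _×_; _,_)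
open import Data.Sum using (inj₁; inj₂)
open import Data.Empty using (⊥-elim)
open import Relation.Nullary using (¬_; yes; no)
open import Relation.Binary.PropositionalEquality
  using (_≡_; refl; sym; trans; cong; cong₂; subst)

module _ {A : Set} where

  ≼⇒++ : ∀ {u v : List A} → Prefix _≡_ u v → ∃[ t ] v ≡ u ++ t
  ≼⇒++ {v = v} [] = v , refl
  ≼⇒++ (refl ∷ u≼v) with t , eq ← ≼⇒++ u≼v = t , cong (_ ∷_) eq

  ++⇒≼ : ∀ (u t : List A) {v} → v ≡ u ++ t → Prefix _≡_ u v
  ++⇒≼ []      t refl = []
  ++⇒≼ (x ∷ u) t refl = refl ∷ ++⇒≼ u t refl

  length-∷ʳ : ∀ (xs : List A) x → length (xs ∷ʳ x) ≡ suc (length xs)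
  length-∷ʳ xs x = trans (length-++ xs) (+-comm (length xs) 1)

  take-length-++ : ∀ (xs ys : List A) → take (length xs) (xs ++ ys) ≡ xs
  take-length-++ []       ys = refl
  take-length-++ (x ∷ xs) ys = cong (x ∷_) (take-length-++ xs ys)

  cut : ∀ i (xs : List A) → i < length xs →
        ∃[ x ] ∃[ r ] (drop i xs ≡ x ∷ r × drop (suc i) xs ≡ r
                       × take (suc i) xs ≡ take i xs ∷ʳ x)
  cut zero    (x ∷ xs) _         = x , xs , refl , refl , refl
  cut (suc i) (x ∷ xs) (s≤s i<n) with y , r , e₁ , e₂ , e₃ ← cut i xs i<n =
    y , r , e₁ , e₂ , cong (x ∷_) e₃

  ↭-cancelˡ : ∀ (p : List A) {xs ys} → p ++ xs ↭ p ++ ys → xs ↭ ys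
  ↭-cancelˡ []      xs↭ys = xs↭ys
  ↭-cancelˡ (x ∷ p) xs↭ys = ↭-cancelˡ p (drop-∷ xs↭ys)

module Rotations {σ} (S : Word σ) where

  n : ℕ
  n = length S

  Rot : Word σ → Set
  Rot w = ∃[ i ] (i < n × w ≡ rot S i)

  rot-Rot : 0 < n → ∀ i → Rot (rot S i)
  rot-Rot pos i with i <? n
  ... | yes i<n = i , i<n , refl
  ... | no  i≮n = 0 , pos ,
        trans (cong₂ _++_ (drop-all i S (≮⇒≥ i≮n)) (take-all i S (≮⇒≥ i≮n)))
              (sym (++-identityʳ S))

  Rot-rotate : ∀ {x r} → Rot (x ∷ r) → Rot (r ∷ʳ x)
  Rot-rotate (i , i<n , eq)
    with y , u , drop-i , drop-1+i , take-1+i ← cut i S i<n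
    with refl , refl ← ∷-injective (trans eq (cong (_++ take i S) drop-i)) =
    subst Rot shifted (rot-Rot (≤-<-trans z≤n i<n) (suc i))
    where
      shifted : rot S (suc i) ≡ (u ++ take i S) ∷ʳ y
      shifted = trans (cong₂ _++_ drop-1+i take-1+i) (sym (++-assoc u (take i S) [ y ]))

  Rot-↭ : ∀ {w} → Rot w → w ↭ S
  Rot-↭ (i , _ , refl) =
    ↭-trans (↭-++-comm (drop i S) (take i S)) (↭-reflexive (take++drop≡id i S))

  Rot-length : ∀ {w} → Rot w → length w ≡ n
  Rot-length r = ↭-length (Rot-↭ r)

  Rot-last : ∀ p {a b} → Rot (p ∷ʳ a) → Rot (p ∷ʳ b) → a ≡ b
  Rot-last p ra rb
    with refl ← ↭-singleton-inv (↭-cancelˡ p (↭-trans (Rot-↭ rb) (↭-sym (Rot-↭ ra)))) = refl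

  node⇒Rot : ∀ {w} → IsNode S w → ∃[ t ] Rot (w ++ t)
  node⇒Rot (i , i<n , w≼) with t , eq ← ≼⇒++ w≼ = t , i , i<n , sym eq

  Rot⇒node : ∀ {w} t → Rot (w ++ t) → IsNode S w
  Rot⇒node {w} t (i , i<n , eq) = i , i<n , ++⇒≼ w t (sym eq)

  node-length : ∀ {w} → IsNode S w → length w ≤ n
  node-length {w} (i , i<n , w≼) =
    subst (length w ≤_) (Rot-length (i , i<n , refl)) (length-mono w≼)

  node-prefix : ∀ u v → IsNode S (u ++ v) → IsNode S u
  node-prefix u v nd with t , r ← node⇒Rot nd = Rot⇒node (v ++ t) (subst Rot (++-assoc u v t) r)

  node-full : ∀ {w} → IsNode S w → length w ≡ n → Rot w
  node-full {w} nd w-full with node⇒Rot nd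
  ... | []    , r = subst Rot (++-identityʳ w) r
  ... | x ∷ t , r = ⊥-elim (m+1+n≢m (length w)
                      (trans (sym (length-++ w)) (trans (Rot-length r) (sym w-full))))

  -- A rotation has no siblings: a sibling would be a rotation differing only
  -- in its last letter.
  Rot-noSiblings : ∀ {ψ} → Rot ψ → NoSiblings S ψ
  Rot-noSiblings rψ ψ′ (ψ′-node , ψ′≢ψ , p , x , y , refl , refl) =
    ψ′≢ψ (cong (p ∷ʳ_) (Rot-last p rψ′ rψ))
    where
      rψ′ : Rot (p ∷ʳ y)
      rψ′ = node-full ψ′-node
              (trans (length-∷ʳ p y) (trans (sym (length-∷ʳ p x)) (Rot-length rψ)))

  FollowedBy : Word σ → Alph σ → Set
  FollowedBy p x = ∀ t → Rot (p ++ t) → ∃[ t′ ] t ≡ x ∷ t′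

  onlyChild⇒FollowedBy : ∀ {p x} → length p < n →
                         (∀ ψ → Child S p ψ → ψ ≡ p ∷ʳ x) → FollowedBy p x
  onlyChild⇒FollowedBy {p} p<n _ [] r =
    ⊥-elim (<-irrefl (trans (cong length (sym (++-identityʳ p))) (Rot-length r)) p<n)
  onlyChild⇒FollowedBy {p} _ onlyChild (e ∷ t) r
    with refl ← ∷ʳ-injectiveʳ p p
                  (onlyChild (p ∷ʳ e) (Rot⇒node t (subst Rot (sym (++-assoc p [ e ] t)) r) , e , refl)) =
    t , refl

  FollowedBy-node : ∀ {p x} → FollowedBy p x → IsNode S p → IsNode S (p ∷ʳ x)
  FollowedBy-node {p} {x} followed nd
    with t , r ← node⇒Rot nd
    with t′ , refl ← followed t r =
    Rot⇒node t′ (subst Rot (sym (++-assoc p [ x ] t′)) r)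

  -- Prepending a letter keeps p followed by x, as long as c p x is not too long:
  -- rotate c to the end and use the property for p.
  FollowedBy-cons : ∀ {p x} → FollowedBy p x → suc (length p) < n → ∀ c → FollowedBy (c ∷ p) x
  FollowedBy-cons {p} _ short c [] r =
    ⊥-elim (<-irrefl (trans (cong (suc ∘ length) (sym (++-identityʳ p))) (Rot-length r)) short)
  FollowedBy-cons {p} followed _ c (e ∷ t) r
    with _ , refl ← followed (e ∷ t ∷ʳ c) (subst Rot (++-assoc p (e ∷ t) [ c ]) (Rot-rotate r)) =
    t , refl

  FollowedBy-noSiblings : ∀ {p x} → FollowedBy p x → NoSiblings S (p ∷ʳ x)
  FollowedBy-noSiblings {p} {x} followed ψ′ (ψ′-node , ψ′≢ψ , q , _ , e , same-parent , refl)
    with refl , refl ← ∷ʳ-injective p q same-parent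
    with t , r ← node⇒Rot ψ′-node
    with _ , refl ← followed (e ∷ t) (subst Rot (++-assoc p [ e ] t) r) =
    ψ′≢ψ refl

  FollowedBy-size : ∀ {p x} → 0 < n → FollowedBy p x → size S p ≡ size S (p ∷ʳ x)
  FollowedBy-size {p} {x} pos followed =
    cong length (filter-≐ (prefix? _≟_ p ∘ rot S) (prefix? _≟_ (p ∷ʳ x) ∘ rot S)
                          ((λ {i} → extend {i}) , (λ {i} → shorten {i})) (upTo n))
    where
      extend : ∀ {i} → p ≼ rot S i → (p ∷ʳ x) ≼ rot S i
      extend {i} p≼
        with t , eq ← ≼⇒++ p≼
        with t′ , refl ← followed t (subst Rot eq (rot-Rot pos i)) =
        ++⇒≼ (p ∷ʳ x) t′ (trans eq (sym (++-assoc p [ x ] t′)))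

      shorten : ∀ {i} → (p ∷ʳ x) ≼ rot S i → p ≼ rot S i
      shorten {i} px≼ with t , eq ← ≼⇒++ px≼ = ++⇒≼ p (x ∷ t) (trans eq (++-assoc p [ x ] t))

module WeinerLinks {σ} (S : Word σ) where

  record LinksThrough (x : Word σ) (L : Alph σ → Set) (τ : Word σ) : Set where
    field
      link⇒ : ∀ {ψ c} → WeinerLink S x ψ c → ψ ≡ c ∷ τ × L c
      ⇒link : ∀ {c} → L c → WeinerLink S x (c ∷ τ) c
  open LinksThrough

  Ext : Word σ → Alph σ → Set
  Ext w c = IsNode S (c ∷ w)

  short-links : ∀ {w} → IsNode S w → length w < length S → LinksThrough w (Ext w) w
  link⇒ (short-links _ _)     (_ , ψ-node , inj₁ refl)  = refl , ψ-node
  link⇒ (short-links _ w<n)   (_ , _ , inj₂ (w-full , _)) = ⊥-elim (<-irrefl w-full w<n)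
  ⇒link (short-links w-node _) c-ext = w-node , c-ext , inj₁ refl

  unique-transfer : ∀ {x y L τ τ′} → LinksThrough x L τ → LinksThrough y L τ′ →
                    HasUniqueWeinerLink S x → ∃[ c ] (L c × UniqueWeinerLinkTo S y (c ∷ τ′) c)
  unique-transfer {y = y} {τ = τ} {τ′} X Y (ψ , c , x-link , x-unique)
    with refl , Lc ← link⇒ X x-link = c , Lc , ⇒link Y Lc , y-unique
    where
      y-unique : ∀ ψ′ d → WeinerLink S y ψ′ d → ψ′ ≡ c ∷ τ′
      y-unique ψ′ d y-link with refl , Ld ← link⇒ Y y-link =
        cong (_∷ τ′) (∷-injectiveˡ (x-unique (d ∷ τ) d (⇒link X Ld)))

  multiple-transfer : ∀ {x y L τ τ′} → LinksThrough x L τ → LinksThrough y L τ′ →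
                      HasMultipleWeinerLinks S x → HasMultipleWeinerLinks S y
  multiple-transfer {τ = τ} {τ′} X Y (_ , c₁ , _ , c₂ , link₁ , link₂ , ψ₁≢ψ₂)
    with refl , L₁ ← link⇒ X link₁
    with refl , L₂ ← link⇒ X link₂ =
    c₁ ∷ τ′ , c₁ , c₂ ∷ τ′ , c₂ , ⇒link Y L₁ , ⇒link Y L₂ ,
    λ same → ψ₁≢ψ₂ (cong (_∷ τ) (∷-injectiveˡ same))

  multiple⇒¬weightOne : ∀ {x} → HasMultipleWeinerLinks S x → ¬ WeightOneCond S x
  multiple⇒¬weightOne (ψ₁ , c₁ , ψ₂ , c₂ , link₁ , link₂ , ψ₁≢ψ₂) (_ , _ , (_ , unique) , _) =
    ψ₁≢ψ₂ (trans (unique ψ₁ c₁ link₁) (sym (unique ψ₂ c₂ link₂)))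

  multiple-weight⇒size : ∀ {k x m} → HasMultipleWeinerLinks S x → Weight S k x m → m ≡ size S x
  multiple-weight⇒size mult (_ , inj₁ (one , _))   = ⊥-elim (multiple⇒¬weightOne mult one)
  multiple-weight⇒size mult (_ , inj₂ (_ , m≡size)) = m≡size

  size⇒multiple-weight : ∀ {k x m} → HasMultipleWeinerLinks S x → AtLevel S k x →
                         m ≡ size S x → Weight S k x m
  size⇒multiple-weight mult level m≡size = level , inj₂ (multiple⇒¬weightOne mult , m≡size)

module OnlyChild {σ} (S : Word σ) (ζ : Word σ) (d : Alph σ)
  (ζ<n : length ζ < length S) (ζ-node : IsNode S ζ) (φ-node : IsNode S (ζ ∷ʳ d))
  (onlyChild : ∀ ψ → Child S ζ ψ → ψ ≡ ζ ∷ʳ d) where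

  open Rotations S
  open WeinerLinks S

  φ : Word σ
  φ = ζ ∷ʳ d

  followed : FollowedBy ζ d
  followed = onlyChild⇒FollowedBy ζ<n onlyChild

  length-φ : length φ ≡ suc (length ζ)
  length-φ = length-∷ʳ ζ d

  LinksOfφ : Word σ → Set
  LinksOfφ τ = LinksThrough φ (Ext ζ) τ × (∀ {c} → Ext ζ c → NoSiblings S (c ∷ τ))

  links-short : suc (length ζ) < n → LinksOfφ φ
  links-short φ<n = record { link⇒ = link⇒φ ; ⇒link = ⇒linkφ } ,
                    λ {c} _ → FollowedBy-noSiblings (FollowedBy-cons followed φ<n c)
    where
      φ-short : LinksThrough φ (Ext φ) φ
      φ-short = short-links φ-node (subst (_< n) (sym length-φ) φ<n)

      link⇒φ : ∀ {ψ c} → WeinerLink S φ ψ c → ψ ≡ c ∷ φ × Ext ζ c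
      link⇒φ {c = c} link with refl , cφ-node ← LinksThrough.link⇒ φ-short link =
        refl , node-prefix (c ∷ ζ) [ d ] cφ-node

      ⇒linkφ : ∀ {c} → Ext ζ c → WeinerLink S φ (c ∷ φ) c
      ⇒linkφ {c} cζ-node =
        LinksThrough.⇒link φ-short (FollowedBy-node (FollowedBy-cons followed φ<n c) cζ-node)

  -- φ of full length: the links of φ drop its last letter, so the targets are c ζ,
  -- themselves rotations.
  links-full : suc (length ζ) ≡ n → LinksOfφ ζ
  links-full φ=n = record { link⇒ = link⇒φ ; ⇒link = ⇒linkφ } ,
                   λ cζ-node → Rot-noSiblings (node-full cζ-node φ=n)
    where
      φ-full : length φ ≡ n
      φ-full = trans length-φ φ=n

      truncate : take (pred n) φ ≡ ζ
      truncate = trans (cong (λ m → take m φ) (cong pred (sym φ=n))) (take-length-++ ζ [ d ])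

      link⇒φ : ∀ {ψ c} → WeinerLink S φ ψ c → ψ ≡ c ∷ ζ × Ext ζ c
      link⇒φ (_ , ψ-node , inj₁ refl)      = ⊥-elim (<-irrefl φ-full (node-length ψ-node))
      link⇒φ (_ , ψ-node , inj₂ (_ , refl)) =
        cong (_ ∷_) truncate , subst (IsNode S) (cong (_ ∷_) truncate) ψ-node

      ⇒linkφ : ∀ {c} → Ext ζ c → WeinerLink S φ (c ∷ ζ) c
      ⇒linkφ cζ-node = φ-node , cζ-node , inj₂ (φ-full , cong (_ ∷_) (sym truncate))

  φ-links : ∃[ τ ] LinksOfφ τ
  φ-links with m≤n⇒m<n∨m≡n ζ<n
  ... | inj₁ φ<n = φ , links-short φ<n
  ... | inj₂ φ=n = ζ , links-full φ=n

  weight-one : HasUniqueWeinerLink S ζ → Weight S (suc (length ζ)) φ 1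
  weight-one ζ-unique
    with τ , φ-linked , noSiblings ← φ-links
    with c , cζ-node , φ-unique ← unique-transfer (short-links ζ-node ζ<n) φ-linked ζ-unique =
    (φ-node , length-φ) , inj₁ ((c ∷ τ , c , φ-unique , noSiblings cζ-node) , refl)

  same-weight : HasMultipleWeinerLinks S ζ → ∀ m →
                (Weight S (length ζ) ζ m → Weight S (suc (length ζ)) φ m)
                × (Weight S (suc (length ζ)) φ m → Weight S (length ζ) ζ m)
  same-weight ζ-multiple m = to , from
    where
      same-size : size S ζ ≡ size S φ
      same-size = FollowedBy-size (≤-<-trans z≤n ζ<n) followed

      φ-multiple : HasMultipleWeinerLinks S φ
      φ-multiple with _ , φ-linked , _ ← φ-links =
        multiple-transfer (short-links ζ-node ζ<n) φ-linked ζ-multiple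

      to : Weight S (length ζ) ζ m → Weight S (suc (length ζ)) φ m
      to w = size⇒multiple-weight φ-multiple (φ-node , length-φ)
               (trans (multiple-weight⇒size ζ-multiple w) same-size)

      from : Weight S (suc (length ζ)) φ m → Weight S (length ζ) ζ m
      from w = size⇒multiple-weight ζ-multiple (ζ-node , refl)
                 (trans (multiple-weight⇒size φ-multiple w) (sym same-size))

lemma5 : ∀ {σ} (S : Word σ) → EndMarked S →
         ∀ (k : ℕ) (ζ φ : Word σ) →
         k < length S → AtLevel S k ζ →
         Child S ζ φ → (∀ ψ → Child S ζ ψ → ψ ≡ φ) →
         (HasUniqueWeinerLink S ζ → Weight S (suc k) φ 1)
         × (HasMultipleWeinerLinks S ζ →
              ∀ m → (Weight S k ζ m → Weight S (suc k) φ m)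
                  × (Weight S (suc k) φ m → Weight S k ζ m))
lemma5 S _ _ ζ _ ζ<n (ζ-node , refl) (φ-node , d , refl) onlyChild =
  weight-one , same-weight
  where open OnlyChild S ζ d ζ<n ζ-node φ-node onlyChild
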